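{- Let $\mathbf{A}=\langle A,\oplus,{}^*,0\rangle$ be an MV-algebra and $\mathbf{B}$ a CMV-subalgebra of the CMV-algebra $\mathbf{A}^A$. Let $J$ be a proper $\diamond$-ideal of $\mathbf{B}$ such that $\Sigma(J)=\bigcap_{f\in J}\operatorname{zero}(f)\neq\varnothing$. Then $\Sigma(J)$ is a $B$-stable subset of $A$.
   Context: $\mathbf{A}^A$ is the set of all functions $A\to A$ with pointwise operations $\oplus,{}^*,0$, composition $\diamond=\circ$ ($(f\circ g)(x)=f(g(x))$) and identity map $i$; it is a CMV-algebra. A CMV-subalgebra is a subset closed under $\oplus,{}^*,0,\circ$ containing $i$. For $f\in B$, $\operatorname{zero}(f)=\{a\in A\mid f(a)=0\}$. A subset $S\subseteq A$ is $B$-stable if $f[S]\subseteq S$ for every $f\in B$. Order: $f\le g$ iff $f^*\oplus g=1$ (with $1=0^*$). A $\diamond$-ideal of $\mathbf{B}$ is a non-empty $I\subseteq B$ such that (i) $f\in I$, $g\le f$ imply $g\in I$; (ii) $f,g\in I$ imply $f\oplus g\in I$; (iii) $f\diamond g\in I$ for all $f\in I$, $g\in B$. Proper means $I\neq B$. -}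

module Defs where

open import Level using (Level; suc; _⊔_)
open import Relation.Binary.PropositionalEquality using (_≡_)
open import Relation.Nullary using (¬_)
open import Data.Product using (Σ; ∃; _×_)
open import Function using (_∘_; id)

record IsMVAlgebra {a} (A : Set a) (_⊕_ : A → A → A) (_* : A → A) (𝟘 : A) : Set a where
  field
    ⊕-assoc : ∀ x y z → (x ⊕ (y ⊕ z)) ≡ ((x ⊕ y) ⊕ z)
    ⊕-comm  : ∀ x y → (x ⊕ y) ≡ (y ⊕ x)
    ⊕-idʳ   : ∀ x → (x ⊕ 𝟘) ≡ x
    *-invol : ∀ x → ((x *) *) ≡ x
    ⊕-absorb : ∀ x → (x ⊕ (𝟘 *)) ≡ (𝟘 *)
    łukasiewicz : ∀ x y → ((((x *) ⊕ y) *) ⊕ y) ≡ ((((y *) ⊕ x) *) ⊕ x)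

record MVAlgebra (a : Level) : Set (suc a) where
  infixl 6 _⊕_
  infix 8 _*
  field
    Carrier : Set a
    _⊕_ : Carrier → Carrier → Carrier
    _* : Carrier → Carrier
    𝟘 : Carrier
    isMVAlgebra : IsMVAlgebra Carrier _⊕_ _* 𝟘
  open IsMVAlgebra isMVAlgebra public

  𝟙 : Carrier
  𝟙 = 𝟘 *

module FunctionAlgebra {a} (𝐀 : MVAlgebra a) where
  open MVAlgebra 𝐀

  _⊕ᶠ_ : (Carrier → Carrier) → (Carrier → Carrier) → (Carrier → Carrier)
  (f ⊕ᶠ g) x = f x ⊕ g x

  _*ᶠ : (Carrier → Carrier) → (Carrier → Carrier)
  (f *ᶠ) x = (f x) *

  𝟘ᶠ : Carrier → Carrier
  𝟘ᶠ _ = 𝟘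

  𝟙ᶠ : Carrier → Carrier
  𝟙ᶠ _ = 𝟙

  _≤ᶠ_ : (Carrier → Carrier) → (Carrier → Carrier) → Set a
  f ≤ᶠ g = ∀ x → ((f *ᶠ) ⊕ᶠ g) x ≡ 𝟙ᶠ x

  Subset : Set (suc a)
  Subset = (Carrier → Carrier) → Set a

  record IsCMVSubalgebra (B : Subset) : Set a where
    field
      𝟘-∈ : B 𝟘ᶠ
      id-∈ : B id
      ⊕-∈ : ∀ {f g} → B f → B g → B (f ⊕ᶠ g)
      *-∈ : ∀ {f} → B f → B (f *ᶠ)
      ∘-∈ : ∀ {f g} → B f → B g → B (f ∘ g)

  -- ◇-ideal of 𝐁 (with ◇ = ∘).
  record IsDiamondIdeal (B : Subset) (I : Subset) : Set a where
    field
      ⊆B : ∀ {f} → I f → B f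
      nonempty : Σ (Carrier → Carrier) I
      down : ∀ {f g} → I f → B g → g ≤ᶠ f → I g
      ⊕-closed : ∀ {f g} → I f → I g → I (f ⊕ᶠ g)
      ∘-closed : ∀ {f g} → I f → B g → I (f ∘ g)

  Proper : (B : Subset) (I : Subset) → Set a
  Proper B I = Σ (Carrier → Carrier) (λ f → B f × ¬ I f)

  zero : (Carrier → Carrier) → Carrier → Set a
  zero f x = f x ≡ 𝟘

  Σ-of : Subset → Carrier → Set a
  Σ-of J x = ∀ f → J f → zero f x

  Stable : {ℓ : Level} → Subset → (Carrier → Set ℓ) → Set (a ⊔ ℓ)
  Stable B S = ∀ f → B f → ∀ x → S x → S (f x)

module Submission where

-- The argument uses only the right-absorption law (iii) of a ◇-ideal:
-- if h ∈ J and g ∈ B then h ∘ g ∈ J.  Given x ∈ Σ(J) and g ∈ B, every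
-- h ∈ J satisfies h (g x) = (h ∘ g) x = 0, because h ∘ g ∈ J and x is a
-- common zero of J; hence g x ∈ Σ(J).

open import Defs
open import Level using (Level)
open import Data.Product using (∃)
open import Function using (_∘_)

module _ {a : Level} (𝐀 : MVAlgebra a) where
  open FunctionAlgebra 𝐀

  RightAbsorbing : Subset → Subset → Set a
  RightAbsorbing B J = ∀ {h g} → J h → B g → J (h ∘ g)

  Σ-stable-of-right-absorbing : (B J : Subset) → RightAbsorbing B J →
    Stable B (Σ-of J)
  Σ-stable-of-right-absorbing B J absorb g g∈B x x∈ΣJ h h∈J =
    x∈ΣJ (h ∘ g) (absorb h∈J g∈B)

mainTheorem12 : {a : Level} (𝐀 : MVAlgebra a) →
    let open FunctionAlgebra 𝐀 in
    (B : Subset) → IsCMVSubalgebra B →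
    (J : Subset) → IsDiamondIdeal B J → Proper B J →
    ∃ (Σ-of J) →
    Stable B (Σ-of J)
mainTheorem12 𝐀 B _ J J-ideal _ _ =
  Σ-stable-of-right-absorbing 𝐀 B J (IsDiamondIdeal.∘-closed J-ideal)
  where open FunctionAlgebra 𝐀
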